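{- Let $X$ be a nonempty set and $n\ge1$. If a family $\mathcal{U}$ of subsets of $X$ is $n$-minimal constructible, then it is $n$-minimal-fat constructible. For $n=1$ the converse holds. The converse fails in general: for $X=\{1,2,3,4,5\}$ and $\mathcal{U}=\{\{1\},\{2\},\{3\},\{4\},\{2,3,4\}\}$, $\mathcal{U}$ is 2-minimal-fat constructible but not 2-minimal constructible.
   Context: For a family $\mathcal{U}$ of subsets of $X$, let $C_1(\mathcal{U})$ be the family of all sets of the form $E_1\cap E_2$, $E_1\cup E_2$ or $X\setminus E_1$ with $E_1,E_2\in\mathcal{U}$ (possibly $E_1=E_2$). Set $C_0(\mathcal{U})=\mathcal{U}$ and $C_n(\mathcal{U})=C_1(C_{n-1}(\mathcal{U}))$ for $n\ge1$. A family $\mathcal{U}$ is $n$-minimal constructible ($n\ge1$) if for every proper subfamily $\mathcal{H}\subsetneq\mathcal{U}$ we have $\mathcal{U}\not\subseteq C_n(\mathcal{H})$. It is $n$-minimal-fat constructible if for every subfamily $\mathcal{H}\subseteq\mathcal{U}$ with $C_{n-1}(\mathcal{U})\subseteq C_n(\mathcal{H})$ we have $\mathcal{H}=\mathcal{U}$. -}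

module Defs where

open import Level using (0ℓ)
open import Data.Nat using (ℕ; zero; suc)
open import Data.Fin using (Fin; toℕ)
open import Data.Product using (Σ; ∃; ∃-syntax; _×_; _,_)
open import Data.Sum using (_⊎_)
open import Relation.Nullary using (¬_)
open import Relation.Binary.PropositionalEquality using (_≡_)

Subset : Set → Set₁
Subset X = X → Set

_≐_ : {X : Set} → Subset X → Subset X → Set
A ≐ B = ∀ x → (A x → B x) × (B x → A x)

_∩_ : {X : Set} → Subset X → Subset X → Subset X
(A ∩ B) x = A x × B x

_∪_ : {X : Set} → Subset X → Subset X → Subset X
(A ∪ B) x = A x ⊎ B x

∁ : {X : Set} → Subset X → Subset X
∁ A x = ¬ A x

Family : Set → Set₂
Family X = Subset X → Set₁

_⊑_ : {X : Set} → Family X → Family X → Set₁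
F ⊑ G = ∀ E → F E → Σ _ λ E' → G E' × (E ≐ E')

_≋_ : {X : Set} → Family X → Family X → Set₁
F ≋ G = (F ⊑ G) × (G ⊑ F)

C₁ : {X : Set} → Family X → Family X
C₁ U E = Σ _ λ E₁ → Σ _ λ E₂ → U E₁ × U E₂ ×
           ((E ≐ (E₁ ∩ E₂)) ⊎ (E ≐ (E₁ ∪ E₂)) ⊎ (E ≐ ∁ E₁))

C : {X : Set} → ℕ → Family X → Family X
C zero    U = U
C (suc n) U = C₁ (C n U)

-- n-minimal constructible: no proper subfamily H ⊊ U has U ⊆ Cₙ(H).
-- Stated in the (classically equivalent) form: every subfamily H ⊆ U with
-- U ⊆ Cₙ(H) equals U.
MinConstr : {X : Set} → ℕ → Family X → Set₂
MinConstr n U = ∀ H → H ⊑ U → U ⊑ C n H → H ≋ U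

MinFatConstr : {X : Set} → ℕ → Family X → Set₂
MinFatConstr zero    U = ∀ H → H ⊑ U → U ⊑ C zero H → H ≋ U  -- unused (n ≥ 1)
MinFatConstr (suc m) U = ∀ H → H ⊑ U → C m U ⊑ C (suc m) H → H ≋ U

-- The example: X = {1,2,3,4,5}, realised as Fin 5 where element x has label toℕ x + 1.
X₅ : Set
X₅ = Fin 5

label : X₅ → ℕ
label x = suc (toℕ x)

⟪_⟫ : ℕ → Subset X₅
⟪ k ⟫ x = label x ≡ k

S234 : Subset X₅
S234 x = (label x ≡ 2) ⊎ (label x ≡ 3) ⊎ (label x ≡ 4)

U₀ : Family X₅
U₀ E = (E ≡ ⟪ 1 ⟫) ⊎ (E ≡ ⟪ 2 ⟫) ⊎ (E ≡ ⟪ 3 ⟫) ⊎ (E ≡ ⟪ 4 ⟫) ⊎ (E ≡ S234)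

-- Minimality implies fat minimality because U ⊆ C_{n-1}(U), and for n = 1 the two notions
-- coincide since C₀(U) = U. For the example, every H ⊆ U₀ missing a generator G misses from
-- C₂(H) a set of C₁(U₀) (G itself, or X ∖ {2,3,4} for G = {2,3,4}): on the five-point set
-- all these families are finite, so this is checked by enumerating, as characteristic
-- vectors, everything C₂ builds from the other four generators. Conversely the four
-- singletons already build {2,3,4} = ({2} ∪ {3}) ∪ ({4} ∪ {4}) in two steps.
module Submission where

open import Defs
import Data.Bool as Bool
open import Data.Empty using (⊥-elim)
open import Data.Fin using (Fin; zero; suc; toℕ)
import Data.Fin as Fin
open import Data.Fin.Properties using (all?)
import Data.Fin.Subset as FS
open import Data.Fin.Subset.Properties
  using (x∈p∩q⁺; x∈p∩q⁻; x∈p∪q⁺; x∈p∪q⁻; x∈∁p⇒x∉p; x∉p⇒x∈∁p; ⊆-antisym)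
open import Data.List using (List; _++_; cartesianProductWith; filter; allFin; map)
open import Data.Vec.Properties using (≡-dec)
open import Data.List.Membership.Propositional using (_∈_; _∉_)
open import Data.List.Membership.DecPropositional (≡-dec {n = 5} Bool._≟_) using (_∉?_)
open import Data.List.Membership.Propositional.Properties
  using (∈-map⁺; ∈-filter⁺; ∈-allFin; ∈-++⁺ˡ; ∈-++⁺ʳ; ∈-cartesianProductWith⁺)
open import Data.Nat using (ℕ; zero; suc; _≤_; s≤s; z≤n)
import Data.Nat as ℕ
open import Data.Product using (Σ; _×_; _,_; proj₁; proj₂)
open import Data.Sum using (_⊎_; inj₁; inj₂)
open import Data.Vec using ([]; _∷_; here; there)
open import Relation.Nullary using (¬_; yes; no; does; ¬?; _⊎-dec_)
open import Relation.Nullary.Decidable using (from-yes)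
open import Relation.Unary using (Decidable)
open import Relation.Binary.PropositionalEquality using (_≡_; refl; sym; subst)

private
  variable
    X : Set
    A B A′ B′ : Subset X
    n : ℕ

≐-refl : A ≐ A
≐-refl x = (λ a → a) , (λ a → a)

≐-sym : A ≐ B → B ≐ A
≐-sym e x = proj₂ (e x) , proj₁ (e x)

≐-trans : {D : Subset X} → A ≐ B → B ≐ D → A ≐ D
≐-trans e f x = (λ a → proj₁ (f x) (proj₁ (e x) a)) , (λ d → proj₂ (e x) (proj₂ (f x) d))

∩-cong : A ≐ A′ → B ≐ B′ → (A ∩ B) ≐ (A′ ∩ B′)
∩-cong e f x = (λ (a , b) → proj₁ (e x) a , proj₁ (f x) b)
             , (λ (a , b) → proj₂ (e x) a , proj₂ (f x) b)

∪-cong : A ≐ A′ → B ≐ B′ → (A ∪ B) ≐ (A′ ∪ B′)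
∪-cong e f x = (λ { (inj₁ a) → inj₁ (proj₁ (e x) a) ; (inj₂ b) → inj₂ (proj₁ (f x) b) })
             , (λ { (inj₁ a) → inj₁ (proj₂ (e x) a) ; (inj₂ b) → inj₂ (proj₂ (f x) b) })

∁-cong : A ≐ A′ → ∁ A ≐ ∁ A′
∁-cong e x = (λ ¬a a → ¬a (proj₂ (e x) a)) , (λ ¬a a → ¬a (proj₁ (e x) a))

∩-idem : A ≐ (A ∩ A)
∩-idem x = (λ a → a , a) , proj₁

⊑-trans : {F G K : Family X} → F ⊑ G → G ⊑ K → F ⊑ K
⊑-trans F⊑G G⊑K E E∈F with F⊑G E E∈F
... | E′ , E′∈G , E≐E′ with G⊑K E′ E′∈G
... | E″ , E″∈K , E′≐E″ = E″ , E″∈K , ≐-trans E≐E′ E′≐E″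

∈⇒∈C₁ : {U : Family X} {E : Subset X} → U E → C₁ U E
∈⇒∈C₁ {E = E} E∈U = E , E , E∈U , E∈U , inj₁ ∩-idem

⊑-C : (k : ℕ) (U : Family X) → U ⊑ C k U
⊑-C zero    U E E∈U = E , E∈U , ≐-refl
⊑-C (suc k) U = ⊑-trans (⊑-C k U) (λ E E∈CkU → E , ∈⇒∈C₁ E∈CkU , ≐-refl)

minConstr⇒minFatConstr : (m : ℕ) (U : Family X) → MinConstr (suc m) U → MinFatConstr (suc m) U
minConstr⇒minFatConstr m U minimal H H⊑U CmU⊑CH = minimal H H⊑U (⊑-trans (⊑-C m U) CmU⊑CH)

minFatConstr₁⇒minConstr₁ : (U : Family X) → MinFatConstr 1 U → MinConstr 1 U
minFatConstr₁⇒minConstr₁ U fat = fat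

⟦_⟧ : FS.Subset n → Subset (Fin n)
⟦ p ⟧ x = x FS.∈ p

⟦∩⟧ : (p q : FS.Subset n) → ⟦ p FS.∩ q ⟧ ≐ (⟦ p ⟧ ∩ ⟦ q ⟧)
⟦∩⟧ p q x = x∈p∩q⁻ p q , x∈p∩q⁺

⟦∪⟧ : (p q : FS.Subset n) → ⟦ p FS.∪ q ⟧ ≐ (⟦ p ⟧ ∪ ⟦ q ⟧)
⟦∪⟧ p q x = x∈p∪q⁻ p q , x∈p∪q⁺

⟦∁⟧ : (p : FS.Subset n) → ⟦ FS.∁ p ⟧ ≐ ∁ ⟦ p ⟧
⟦∁⟧ p x = x∈∁p⇒x∉p , x∉p⇒x∈∁p

⟦⟧-injective : {p q : FS.Subset n} → ⟦ p ⟧ ≐ ⟦ q ⟧ → p ≡ q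
⟦⟧-injective e = ⊆-antisym (λ {x} → proj₁ (e x)) (λ {x} → proj₂ (e x))

characteristic : {P : Subset (Fin n)} → Decidable P → FS.Subset n
characteristic {zero}  P? = []
characteristic {suc n} P? = does (P? zero) ∷ characteristic (λ x → P? (suc x))

⟦characteristic⟧ : {P : Subset (Fin n)} (P? : Decidable P) → ⟦ characteristic P? ⟧ ≐ P
⟦characteristic⟧ {suc n} P? zero with P? zero
... | yes p = (λ _ → p) , (λ _ → here)
... | no ¬p = (λ ()) , (λ p → ⊥-elim (¬p p))
⟦characteristic⟧ {suc n} P? (suc x) =
  (λ { (there x∈) → proj₁ (tail x) x∈ }) , (λ p → there (proj₂ (tail x) p))
  where tail = ⟦characteristic⟧ (λ y → P? (suc y))

C₁-list : List (FS.Subset n) → List (FS.Subset n)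
C₁-list ps = cartesianProductWith FS._∩_ ps ps ++ cartesianProductWith FS._∪_ ps ps ++ map FS.∁ ps

C-list : ℕ → List (FS.Subset n) → List (FS.Subset n)
C-list zero    ps = ps
C-list (suc k) ps = C₁-list (C-list k ps)

Coded : List (FS.Subset n) → Subset (Fin n) → Set
Coded ps E = Σ _ λ p → p ∈ ps × E ≐ ⟦ p ⟧

C₁-coded : {ps : List (FS.Subset n)} {E E₁ E₂ : Subset (Fin n)} →
           Coded ps E₁ → Coded ps E₂ →
           (E ≐ (E₁ ∩ E₂)) ⊎ (E ≐ (E₁ ∪ E₂)) ⊎ (E ≐ ∁ E₁) → Coded (C₁-list ps) E
C₁-coded (p , p∈ , E₁≐p) (q , q∈ , E₂≐q) (inj₁ E≐∩) =
  p FS.∩ q , ∈-++⁺ˡ (∈-cartesianProductWith⁺ FS._∩_ p∈ q∈) ,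
  ≐-trans E≐∩ (≐-trans (∩-cong E₁≐p E₂≐q) (≐-sym (⟦∩⟧ p q)))
C₁-coded {ps = ps} (p , p∈ , E₁≐p) (q , q∈ , E₂≐q) (inj₂ (inj₁ E≐∪)) =
  p FS.∪ q ,
  ∈-++⁺ʳ (cartesianProductWith FS._∩_ ps ps) (∈-++⁺ˡ (∈-cartesianProductWith⁺ FS._∪_ p∈ q∈)) ,
  ≐-trans E≐∪ (≐-trans (∪-cong E₁≐p E₂≐q) (≐-sym (⟦∪⟧ p q)))
C₁-coded {ps = ps} (p , p∈ , E₁≐p) _ (inj₂ (inj₂ E≐∁)) =
  FS.∁ p ,
  ∈-++⁺ʳ (cartesianProductWith FS._∩_ ps ps)
    (∈-++⁺ʳ (cartesianProductWith FS._∪_ ps ps) (∈-map⁺ FS.∁ p∈)) ,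
  ≐-trans E≐∁ (≐-trans (∁-cong E₁≐p) (≐-sym (⟦∁⟧ p)))

C-coded : {H : Family (Fin n)} {P : Subset (Fin n) → Set} (ps : List (FS.Subset n)) →
          (∀ E → H E → P E ⊎ Coded ps E) →
          ∀ k E → C k H E → (Σ _ λ E′ → H E′ × P E′) ⊎ Coded (C-list k ps) E
C-coded ps split zero E E∈H with split E E∈H
... | inj₁ PE    = inj₁ (E , E∈H , PE)
... | inj₂ coded = inj₂ coded
C-coded ps split (suc k) E (E₁ , E₂ , E₁∈ , E₂∈ , op)
  with C-coded ps split k E₁ E₁∈ | C-coded ps split k E₂ E₂∈
... | inj₁ found | _          = inj₁ found
... | inj₂ _     | inj₁ found = inj₁ found
... | inj₂ c₁    | inj₂ c₂    = inj₂ (C₁-coded c₁ c₂ op)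

⟪_⟫? : (k : ℕ) → Decidable ⟪ k ⟫
⟪ k ⟫? x = label x ℕ.≟ k

S234? : Decidable S234
S234? x = ⟪ 2 ⟫? x ⊎-dec ⟪ 3 ⟫? x ⊎-dec ⟪ 4 ⟫? x

generator : Fin 5 → Subset X₅
generator zero                         = ⟪ 1 ⟫
generator (suc zero)                   = ⟪ 2 ⟫
generator (suc (suc zero))             = ⟪ 3 ⟫
generator (suc (suc (suc zero)))       = ⟪ 4 ⟫
generator (suc (suc (suc (suc zero)))) = S234

generator? : ∀ i → Decidable (generator i)
generator? zero                         = ⟪ 1 ⟫?
generator? (suc zero)                   = ⟪ 2 ⟫?
generator? (suc (suc zero))             = ⟪ 3 ⟫?
generator? (suc (suc (suc zero)))       = ⟪ 4 ⟫?
generator? (suc (suc (suc (suc zero)))) = S234?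

generator∈U₀ : ∀ i → U₀ (generator i)
generator∈U₀ zero                         = inj₁ refl
generator∈U₀ (suc zero)                   = inj₂ (inj₁ refl)
generator∈U₀ (suc (suc zero))             = inj₂ (inj₂ (inj₁ refl))
generator∈U₀ (suc (suc (suc zero)))       = inj₂ (inj₂ (inj₂ (inj₁ refl)))
generator∈U₀ (suc (suc (suc (suc zero)))) = inj₂ (inj₂ (inj₂ (inj₂ refl)))

U₀⇒generator : ∀ {E} → U₀ E → Σ (Fin 5) λ i → E ≡ generator i
U₀⇒generator (inj₁ e)                   = zero , e
U₀⇒generator (inj₂ (inj₁ e))             = suc zero , e
U₀⇒generator (inj₂ (inj₂ (inj₁ e)))       = suc (suc zero) , e
U₀⇒generator (inj₂ (inj₂ (inj₂ (inj₁ e)))) = suc (suc (suc zero)) , e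
U₀⇒generator (inj₂ (inj₂ (inj₂ (inj₂ e)))) = suc (suc (suc (suc zero))) , e

codesWithout : Fin 5 → List (FS.Subset 5)
codesWithout j = map (λ i → characteristic (generator? i)) (filter (λ i → ¬? (i Fin.≟ j)) (allFin 5))

generator-or-coded : ∀ {H} → H ⊑ U₀ → ∀ j E → H E → (generator j ≐ E) ⊎ Coded (codesWithout j) E
generator-or-coded H⊑U₀ j E E∈H with H⊑U₀ E E∈H
... | E′ , E′∈U₀ , E≐E′ with U₀⇒generator E′∈U₀
... | i , refl with i Fin.≟ j
... | yes refl = inj₁ (≐-sym E≐E′)
... | no i≢j   = inj₂ (characteristic (generator? i) ,
                       ∈-map⁺ _ (∈-filter⁺ (λ i → ¬? (i Fin.≟ j)) (∈-allFin i) i≢j) ,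
                       ≐-trans E≐E′ (≐-sym (⟦characteristic⟧ (generator? i))))

target : Fin 5 → Subset X₅
target zero                         = ⟪ 1 ⟫
target (suc zero)                   = ⟪ 2 ⟫
target (suc (suc zero))             = ⟪ 3 ⟫
target (suc (suc (suc zero)))       = ⟪ 4 ⟫
target (suc (suc (suc (suc zero)))) = ∁ S234

target? : ∀ j → Decidable (target j)
target? zero                         = ⟪ 1 ⟫?
target? (suc zero)                   = ⟪ 2 ⟫?
target? (suc (suc zero))             = ⟪ 3 ⟫?
target? (suc (suc (suc zero)))       = ⟪ 4 ⟫?
target? (suc (suc (suc (suc zero)))) = λ x → ¬? (S234? x)

target∈C₁U₀ : ∀ j → C₁ U₀ (target j)
target∈C₁U₀ zero                         = ∈⇒∈C₁ (generator∈U₀ zero)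
target∈C₁U₀ (suc zero)                   = ∈⇒∈C₁ (generator∈U₀ (suc zero))
target∈C₁U₀ (suc (suc zero))             = ∈⇒∈C₁ (generator∈U₀ (suc (suc zero)))
target∈C₁U₀ (suc (suc (suc zero)))       = ∈⇒∈C₁ (generator∈U₀ (suc (suc (suc zero))))
target∈C₁U₀ (suc (suc (suc (suc zero)))) = S234 , S234 , inj₂ (inj₂ (inj₂ (inj₂ refl))) ,
                                           inj₂ (inj₂ (inj₂ (inj₂ refl))) , inj₂ (inj₂ ≐-refl)

target∉C₂-without : ∀ j → characteristic (target? j) ∉ C-list 2 (codesWithout j)
target∉C₂-without = from-yes (all? λ j → characteristic (target? j) ∉? C-list 2 (codesWithout j))

generator-needed : ∀ {H} → H ⊑ U₀ → C 1 U₀ ⊑ C 2 H → ∀ j → Σ _ λ E → H E × generator j ≐ E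
generator-needed H⊑U₀ C₁U₀⊑C₂H j with C₁U₀⊑C₂H (target j) (target∈C₁U₀ j)
... | E , E∈C₂H , target≐E with C-coded (codesWithout j) (generator-or-coded H⊑U₀ j) 2 E E∈C₂H
... | inj₁ found           = found
... | inj₂ (p , p∈ , E≐p) =
  ⊥-elim (target∉C₂-without j (subst (_∈ C-list 2 (codesWithout j)) (sym code≡p) p∈))
  where
  code≡p : characteristic (target? j) ≡ p
  code≡p = ⟦⟧-injective (≐-trans (⟦characteristic⟧ (target? j)) (≐-trans target≐E E≐p))

U₀-minFat : MinFatConstr 2 U₀
U₀-minFat H H⊑U₀ C₁U₀⊑C₂H = H⊑U₀ , U₀⊑H
  where
  U₀⊑H : U₀ ⊑ H
  U₀⊑H E E∈U₀ with U₀⇒generator E∈U₀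
  ... | i , refl = generator-needed H⊑U₀ C₁U₀⊑C₂H i

singletons : Family X₅
singletons E = Σ (Fin 4) λ i → E ≡ ⟪ suc (toℕ i) ⟫

singletons⊑U₀ : singletons ⊑ U₀
singletons⊑U₀ E (zero , e)                 = E , inj₁ e , ≐-refl
singletons⊑U₀ E (suc zero , e)             = E , inj₂ (inj₁ e) , ≐-refl
singletons⊑U₀ E (suc (suc zero) , e)       = E , inj₂ (inj₂ (inj₁ e)) , ≐-refl
singletons⊑U₀ E (suc (suc (suc zero)) , e) = E , inj₂ (inj₂ (inj₂ (inj₁ e))) , ≐-refl

S234≐⟪2⟫∪⟪3⟫∪⟪4⟫ : S234 ≐ ((⟪ 2 ⟫ ∪ ⟪ 3 ⟫) ∪ (⟪ 4 ⟫ ∪ ⟪ 4 ⟫))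
S234≐⟪2⟫∪⟪3⟫∪⟪4⟫ x =
  (λ { (inj₁ a) → inj₁ (inj₁ a) ; (inj₂ (inj₁ a)) → inj₁ (inj₂ a) ; (inj₂ (inj₂ a)) → inj₂ (inj₁ a) }) ,
  (λ { (inj₁ (inj₁ a)) → inj₁ a ; (inj₁ (inj₂ a)) → inj₂ (inj₁ a)
       ; (inj₂ (inj₁ a)) → inj₂ (inj₂ a) ; (inj₂ (inj₂ a)) → inj₂ (inj₂ a) })

U₀⊑C₂singletons : U₀ ⊑ C 2 singletons
U₀⊑C₂singletons E (inj₁ e)                      = ⊑-C 2 singletons E (zero , e)
U₀⊑C₂singletons E (inj₂ (inj₁ e))               = ⊑-C 2 singletons E (suc zero , e)
U₀⊑C₂singletons E (inj₂ (inj₂ (inj₁ e)))        = ⊑-C 2 singletons E (suc (suc zero) , e)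
U₀⊑C₂singletons E (inj₂ (inj₂ (inj₂ (inj₁ e)))) = ⊑-C 2 singletons E (suc (suc (suc zero)) , e)
U₀⊑C₂singletons E (inj₂ (inj₂ (inj₂ (inj₂ refl)))) =
  _ , (⟪ 2 ⟫ ∪ ⟪ 3 ⟫ , ⟪ 4 ⟫ ∪ ⟪ 4 ⟫
      , (⟪ 2 ⟫ , ⟪ 3 ⟫ , (suc zero , refl) , (suc (suc zero) , refl) , inj₂ (inj₁ ≐-refl))
      , (⟪ 4 ⟫ , ⟪ 4 ⟫ , (suc (suc (suc zero)) , refl) , (suc (suc (suc zero)) , refl) , inj₂ (inj₁ ≐-refl))
      , inj₂ (inj₁ ≐-refl))
  , S234≐⟪2⟫∪⟪3⟫∪⟪4⟫

S234≉⟪_⟫ : ∀ k → ¬ (S234 ≐ ⟪ k ⟫)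
S234≉⟪ k ⟫ e with proj₁ (e (suc zero)) (inj₁ refl) | proj₁ (e (suc (suc zero))) (inj₂ (inj₁ refl))
... | refl | ()

U₀-not-min : ¬ MinConstr 2 U₀
U₀-not-min minimal
  with proj₂ (minimal singletons singletons⊑U₀ U₀⊑C₂singletons) S234 (inj₂ (inj₂ (inj₂ (inj₂ refl))))
... | _ , (_ , refl) , S234≐E = S234≉⟪ _ ⟫ S234≐E

lemma6p13 : ((X : Set) → X → (n : ℕ) → 1 ≤ n → (U : Family X) → MinConstr n U → MinFatConstr n U)
    × ((X : Set) → X → (U : Family X) → MinFatConstr 1 U → MinConstr 1 U)
    × (MinFatConstr 2 U₀ × ¬ MinConstr 2 U₀)
lemma6p13 =
  (λ { _ _ (suc m) (s≤s z≤n) → minConstr⇒minFatConstr m }) ,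
  (λ _ _ → minFatConstr₁⇒minConstr₁) ,
  U₀-minFat ,
  U₀-not-min
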